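{- Let $1<p<q$ be relatively prime integers, let $S$ be a word of length $p+q-2$ over an alphabet $\Sigma$ that has periods $p$ and $q$ but does not have period $1$, and let $k=\lfloor q/p\rfloor$. Then the partial word $$W=(S[0..p-3]\,\diamondsuit\diamondsuit)^{k}\cdot S\cdot(\diamondsuit\diamondsuit\, S[q..q+p-3])^{k}$$ has periods $p$ and $q$.
   Context: A partial word is a sequence over $\Sigma\cup\{\diamondsuit\}$, where $\diamondsuit\notin\Sigma$ is a hole; positions are numbered from $0$ and $S[i..j]$ denotes the factor from position $i$ to position $j$. For $a,b\in\Sigma\cup\{\diamondsuit\}$, $a\approx b$ if $a=b$ or one of them is $\diamondsuit$. A positive integer $r$ is a (strong) period of a partial word $X$ of length $n$ if there is a word $P\in\Sigma^r$ with $X[i]\approx P[i\bmod r]$ for all $0\le i<n$; for a solid word this is the usual notion of period. -}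

module Defs where

open import Data.Nat using (ℕ; zero; suc; _+_; _<_; NonZero)
open import Data.Nat.DivMod using (_mod_)
open import Data.Fin using (Fin; toℕ)
open import Data.List using (List; []; _∷_; length; lookup; _++_; concat; replicate; take; drop)
open import Data.Vec as Vec using (Vec)
open import Data.Maybe using (Maybe; just; nothing)
open import Data.Product using (Σ; _×_)
open import Data.Unit using (⊤)
open import Relation.Binary.PropositionalEquality using (_≡_)

-- Partial words over A: hole ♢ is `nothing`, a letter c is `just c`.
PartialWord : Set → Set
PartialWord A = List (Maybe A)

♢ : {A : Set} → Maybe A
♢ = nothing

solid : {A : Set} → List A → PartialWord A
solid [] = []
solid (c ∷ w) = just c ∷ solid w

_≈_ : {A : Set} → Maybe A → Maybe A → Set
nothing ≈ _ = ⊤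
just a ≈ nothing = ⊤
just a ≈ just b = a ≡ b

at : {A : Set} → List A → ℕ → Maybe A
at [] _ = nothing
at (x ∷ xs) zero = just x
at (x ∷ xs) (suc i) = at xs i

Period : {A : Set} → List A → ℕ → Set
Period S r = (0 < r) × (∀ i → i + r < length S → at S i ≡ at S (i + r))

StrongPeriod : {A : Set} → PartialWord A → ℕ → Set
StrongPeriod {A} X r =
  Σ (NonZero r) λ nz → Σ (Vec A r) λ P →
    ∀ (i : Fin (length X)) →
      lookup X i ≈ just (Vec.lookup P (_mod_ (toℕ i) r {{nz}}))

_^^_ : {A : Set} → List A → ℕ → List A
w ^^ k = concat (replicate k w)

factor : {A : Set} → List A → ℕ → ℕ → List A
factor S i len = take len (drop i S)

module Submission where

-- A partial word has strong period r as soon as its letters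
-- agree with some r-periodic function f : ℕ → Maybe A (holes are free; the
-- vector P of the definition is f on 0, …, r-1).  Agreement ("matching") is
-- compositional: concatenations and powers match f iff their pieces match
-- the shifted f, and a solid word matches f iff it equals f on its domain.
-- Hence for W = (S[0..p-3] ♢♢)^k · S · (♢♢ S[q..q+p-3])^k it suffices to give,
-- for r ∈ {p, q}, an r-periodic f satisfying pointwise equations for the
-- prefix blocks, for the middle S and for the suffix blocks (`matches-W`).
-- For r = p we take the p-periodic extension x ↦ S[x mod p] of S; for r = q
-- the q-periodic extension shifted by E = q - kp, which agrees with S on the
-- middle copy; the block equations then follow by moving inside S with the
-- periods p and q.

open import Defs
open import Data.Nat using (ℕ; zero; suc; _+_; _*_; _∸_; _<_; _≤_; _/_; _%_; _⊓_; NonZero; z<s; s≤s; >-nonZero)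
open import Data.Nat.Properties
open import Data.Nat.DivMod using (_mod_; m≡m%n+[m/n]*n; [m+n]%n≡m%n; m/n*n≤m)
open import Data.Nat.Tactic.RingSolver using (solve; solve-∀)
open import Data.Nat.Coprimality using (Coprime)
open import Data.List using (List; []; _∷_; _++_; length; lookup; take; drop)
open import Data.List.Properties using (length-++; length-take; length-drop)
open import Data.Maybe using (Maybe; just; nothing; fromMaybe)
open import Data.Fin using (Fin; toℕ)
open import Data.Fin.Properties using (toℕ-fromℕ<)
open import Data.Vec as Vec using (tabulate)
open import Data.Vec.Properties using (lookup∘tabulate)
open import Data.Product using (_×_; _,_; proj₂)
open import Data.Unit using (⊤; tt)
open import Function using (_∘_)
open import Relation.Binary.PropositionalEquality
open import Relation.Nullary using (¬_)

shift : {B : Set} → ℕ → (ℕ → B) → ℕ → B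
shift o f i = f (o + i)

at-take : {B : Set} (len : ℕ) (L : List B) (i : ℕ) → i < length (take len L) → at (take len L) i ≡ at L i
at-take (suc len) (x ∷ L) zero _ = refl
at-take (suc len) (x ∷ L) (suc i) (s≤s i<) = at-take len L i i<

at-drop : {B : Set} (o : ℕ) (L : List B) (i : ℕ) → at (drop o L) i ≡ at L (o + i)
at-drop zero L i = refl
at-drop (suc o) [] i = refl
at-drop (suc o) (x ∷ L) i = at-drop o L i

length-solid : {A : Set} (S : List A) → length (solid S) ≡ length S
length-solid [] = refl
length-solid (c ∷ S) = cong suc (length-solid S)

length-factor : {A : Set} (S : List A) (o len : ℕ) → o + len ≤ length S → length (factor S o len) ≡ len
length-factor S o len fits = begin
  length (take len (drop o S))  ≡⟨ length-take len (drop o S) ⟩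
  len ⊓ length (drop o S)       ≡⟨ cong (len ⊓_) (length-drop o S) ⟩
  len ⊓ (length S ∸ o)          ≡⟨ m≤n⇒m⊓n≡m (m+n≤o⇒m≤o∸n len (subst (_≤ length S) (+-comm o len) fits)) ⟩
  len                           ∎
  where open ≡-Reasoning

length-^^ : {B : Set} (X : List B) (k : ℕ) → length (X ^^ k) ≡ k * length X
length-^^ X zero = refl
length-^^ X (suc k) = trans (length-++ X) (cong (length X +_) (length-^^ X k))

Matches : {A : Set} → PartialWord A → (ℕ → Maybe A) → Set
Matches [] f = ⊤
Matches (nothing ∷ X) f = Matches X (f ∘ suc)
Matches (just c ∷ X) f = just c ≡ f 0 × Matches X (f ∘ suc)

matches-resp : {A : Set} (X : PartialWord A) {f g : ℕ → Maybe A} →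
  (∀ i → f i ≡ g i) → Matches X f → Matches X g
matches-resp [] f≗g _ = tt
matches-resp (nothing ∷ X) f≗g m = matches-resp X (f≗g ∘ suc) m
matches-resp (just c ∷ X) f≗g (c≡ , m) = trans c≡ (f≗g 0) , matches-resp X (f≗g ∘ suc) m

matches-++ : {A : Set} (X Y : PartialWord A) (f : ℕ → Maybe A) {ℓ : ℕ} → length X ≡ ℓ →
  Matches X f → Matches Y (shift ℓ f) → Matches (X ++ Y) f
matches-++ [] Y f refl _ mY = mY
matches-++ (nothing ∷ X) Y f refl mX mY = matches-++ X Y (f ∘ suc) refl mX mY
matches-++ (just c ∷ X) Y f refl (c≡ , mX) mY = c≡ , matches-++ X Y (f ∘ suc) refl mX mY

matches-^^ : {A : Set} (X : PartialWord A) (k : ℕ) (f : ℕ → Maybe A) {ℓ : ℕ} → length X ≡ ℓ →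
  (∀ a → a < k → Matches X (shift (a * ℓ) f)) → Matches (X ^^ k) f
matches-^^ X zero f _ _ = tt
matches-^^ X (suc k) f {ℓ} len≡ copies =
  matches-++ X (X ^^ k) f len≡ (copies 0 z<s)
    (matches-^^ X k (shift ℓ f) len≡ λ a a<k →
      matches-resp X (λ i → cong f (+-assoc ℓ (a * ℓ) i)) (copies (suc a) (s≤s a<k)))

matches-solid : {A : Set} (S : List A) (f : ℕ → Maybe A) →
  (∀ t → t < length S → at S t ≡ f t) → Matches (solid S) f
matches-solid [] f _ = tt
matches-solid (c ∷ S) f agree = agree 0 z<s , matches-solid S (f ∘ suc) (λ t t< → agree (suc t) (s≤s t<))

matches-factor : {A : Set} (S : List A) (o len : ℕ) (f : ℕ → Maybe A) →
  (∀ t → t < len → at S (o + t) ≡ f t) → Matches (solid (factor S o len)) f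
matches-factor S o len f agree = matches-solid (factor S o len) f λ t t<ℓ →
  trans (at-take len (drop o S) t t<ℓ) (trans (at-drop o S t) (agree t (<-≤-trans t<ℓ length≤len)))
  where
  length≤len : length (factor S o len) ≤ len
  length≤len = ≤-trans (≤-reflexive (length-take len (drop o S))) (m⊓n≤m len (length (drop o S)))

matches-lookup : {A : Set} (d : A) (X : PartialWord A) (f : ℕ → Maybe A) → Matches X f →
  (i : Fin (length X)) → lookup X i ≈ just (fromMaybe d (f (toℕ i)))
matches-lookup d (nothing ∷ X) f m Fin.zero = tt
matches-lookup d (just c ∷ X) f (c≡ , m) Fin.zero = cong (fromMaybe d) c≡
matches-lookup d (nothing ∷ X) f m (Fin.suc i) = matches-lookup d X (f ∘ suc) m i
matches-lookup d (just c ∷ X) f (_ , m) (Fin.suc i) = matches-lookup d X (f ∘ suc) m i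

Periodic : {B : Set} → (ℕ → B) → ℕ → Set
Periodic f r = ∀ x → f (x + r) ≡ f x

periodic-steps : {B : Set} (f : ℕ → B) (r : ℕ) → Periodic f r → ∀ m x → f (m * r + x) ≡ f x
periodic-steps f r per zero x = refl
periodic-steps f r per (suc m) x = begin
  f ((r + m * r) + x)  ≡⟨ cong f (solve (r ∷ m ∷ x ∷ [])) ⟩
  f ((m * r + x) + r)  ≡⟨ per (m * r + x) ⟩
  f (m * r + x)        ≡⟨ periodic-steps f r per m x ⟩
  f x                  ∎
  where open ≡-Reasoning

periodic-mod : {B : Set} (f : ℕ → B) (r : ℕ) .{{_ : NonZero r}} → Periodic f r → ∀ x → f (x % r) ≡ f x
periodic-mod f r per x = begin
  f (x % r)                ≡⟨ periodic-steps f r per (x / r) (x % r) ⟨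
  f ((x / r) * r + x % r)  ≡⟨ cong f (trans (m≡m%n+[m/n]*n x r) (+-comm (x % r) _)) ⟨
  f x                      ∎
  where open ≡-Reasoning

matches⇒strongPeriod : {A : Set} (d : A) (X : PartialWord A) (r : ℕ) {{_ : NonZero r}}
  (f : ℕ → Maybe A) → Periodic f r → Matches X f → StrongPeriod X r
matches⇒strongPeriod {A} d X r {{nz}} f per m = nz , tabulate (value ∘ toℕ) , compatible
  where
  value : ℕ → A
  value = fromMaybe d ∘ f
  compatible : ∀ i → lookup X i ≈ just (Vec.lookup (tabulate (value ∘ toℕ)) (toℕ i mod r))
  compatible i = subst (λ v → lookup X i ≈ just v) value≡ (matches-lookup d X f m i)
    where
    value≡ : value (toℕ i) ≡ Vec.lookup (tabulate (value ∘ toℕ)) (toℕ i mod r)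
    value≡ = sym (trans (lookup∘tabulate (value ∘ toℕ) (toℕ i mod r))
                        (trans (cong value (toℕ-fromℕ< _)) (cong (fromMaybe d) (periodic-mod f r per (toℕ i)))))

period-steps : {A : Set} (S : List A) (r : ℕ) → Period S r →
  ∀ m x → x + m * r < length S → at S x ≡ at S (x + m * r)
period-steps S r _ zero x _ = cong (at S) (sym (+-identityʳ x))
period-steps S r per@(_ , step) (suc m) x fits = begin
  at S x                  ≡⟨ step x (≤-<-trans (+-monoʳ-≤ x (m≤m+n r (m * r))) fits) ⟩
  at S (x + r)            ≡⟨ period-steps S r per m (x + r) (subst (_< length S) reassoc fits) ⟩
  at S (x + r + m * r)    ≡⟨ cong (at S) reassoc ⟨
  at S (x + (r + m * r))  ∎
  where
  open ≡-Reasoning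
  reassoc : x + (r + m * r) ≡ x + r + m * r
  reassoc = sym (+-assoc x r (m * r))

extension : {A : Set} → List A → (r : ℕ) .{{_ : NonZero r}} → ℕ → Maybe A
extension S r x = at S (x % r)

extension-periodic : {A : Set} (S : List A) (r : ℕ) .{{_ : NonZero r}} → Periodic (extension S r) r
extension-periodic S r x = cong (at S) ([m+n]%n≡m%n x r)

extension-agrees : {A : Set} (S : List A) (r : ℕ) .{{_ : NonZero r}} → Period S r →
  ∀ t → t < length S → at S t ≡ extension S r t
extension-agrees S r per t t<n = begin
  at S t                         ≡⟨ cong (at S) t≡ ⟩
  at S (t % r + (t / r) * r)     ≡⟨ period-steps S r per (t / r) (t % r) (subst (_< length S) t≡ t<n) ⟨
  at S (t % r)                   ∎
  where
  open ≡-Reasoning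
  t≡ : t ≡ t % r + (t / r) * r
  t≡ = m≡m%n+[m/n]*n t r

some-letter : {A : Set} (S : List A) → 0 < length S → A
some-letter (c ∷ _) _ = c

module Construction {A : Set} (p q : ℕ) (1<p : 1 < p) (p<q : p < q)
    (S : List A) (length≡ : length S ≡ p + q ∸ 2) (period-p : Period S p) (period-q : Period S q) where

  0<p : 0 < p
  0<p = <-trans z<s 1<p

  0<q : 0 < q
  0<q = <-trans 0<p p<q

  instance
    p-nonZero : NonZero p
    p-nonZero = >-nonZero 0<p
    q-nonZero : NonZero q
    q-nonZero = >-nonZero 0<q

  n k : ℕ
  n = length S
  k = q / p

  prefixBlock suffixBlock W : PartialWord A
  prefixBlock = solid (factor S 0 (p ∸ 2)) ++ ♢ ∷ ♢ ∷ []
  suffixBlock = ♢ ∷ ♢ ∷ solid (factor S q (p ∸ 2))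
  W = prefixBlock ^^ k ++ solid S ++ suffixBlock ^^ k

  suffix-end : q + (p ∸ 2) ≡ n
  suffix-end = trans (sym (+-∸-assoc q 1<p)) (trans (cong (_∸ 2) (+-comm q p)) (sym length≡))

  n+2≡p+q : n + 2 ≡ p + q
  n+2≡p+q = trans (cong (_+ 2) length≡) (m∸n+n≡m (≤-trans 1<p (m≤m+n p q)))

  kp≤q : k * p ≤ q
  kp≤q = m/n*n≤m q p

  prefix-fits : p ∸ 2 ≤ n
  prefix-fits = subst (p ∸ 2 ≤_) suffix-end (m≤n+m (p ∸ 2) q)

  in-prefix : ∀ {b} → b < p ∸ 2 → b < n
  in-prefix b< = <-≤-trans b< prefix-fits

  in-suffix : ∀ {z} → z < p ∸ 2 → q + z < n
  in-suffix z< = subst (q + _ <_) suffix-end (+-monoʳ-< q z<)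

  0<n : 0 < n
  0<n = <-≤-trans 0<q (subst (q ≤_) suffix-end (m≤m+n q (p ∸ 2)))

  length-prefixBlock : length prefixBlock ≡ p
  length-prefixBlock = begin
    length prefixBlock  ≡⟨ length-++ (solid (factor S 0 (p ∸ 2))) ⟩
    length (solid (factor S 0 (p ∸ 2))) + 2
      ≡⟨ cong (_+ 2) (trans (length-solid (factor S 0 (p ∸ 2))) (length-factor S 0 (p ∸ 2) prefix-fits)) ⟩
    p ∸ 2 + 2           ≡⟨ m∸n+n≡m 1<p ⟩
    p                   ∎
    where open ≡-Reasoning

  length-suffixBlock : length suffixBlock ≡ p
  length-suffixBlock = begin
    2 + length (solid (factor S q (p ∸ 2)))
      ≡⟨ cong (2 +_) (trans (length-solid (factor S q (p ∸ 2))) (length-factor S q (p ∸ 2) (≤-reflexive suffix-end))) ⟩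
    2 + (p ∸ 2)  ≡⟨ m+[n∸m]≡n 1<p ⟩
    p            ∎
    where open ≡-Reasoning

  matches-W : (f : ℕ → Maybe A) →
    (∀ a → a < k → ∀ b → b < p ∸ 2 → at S b ≡ f (a * p + b)) →
    (∀ t → t < n → at S t ≡ f (k * p + t)) →
    (∀ a → a < k → ∀ z → z < p ∸ 2 → at S (q + z) ≡ f (k * p + (n + (a * p + (2 + z))))) →
    Matches W f
  matches-W f prefix middle suffix =
    matches-++ (prefixBlock ^^ k) _ f (trans (length-^^ prefixBlock k) (cong (k *_) length-prefixBlock))
      (matches-^^ prefixBlock k f length-prefixBlock λ a a<k →
        matches-++ (solid (factor S 0 (p ∸ 2))) (♢ ∷ ♢ ∷ []) _ refl
          (matches-factor S 0 (p ∸ 2) _ (prefix a a<k)) tt)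
      (matches-++ (solid S) _ _ (length-solid S)
        (matches-solid S _ middle)
        (matches-^^ suffixBlock k _ length-suffixBlock λ a a<k →
          matches-factor S q (p ∸ 2) _ (suffix a a<k)))

  strongPeriod-p : StrongPeriod W p
  strongPeriod-p =
    matches⇒strongPeriod (some-letter S 0<n) W p g periodic (matches-W g prefix middle suffix)
    where
    open ≡-Reasoning
    g : ℕ → Maybe A
    g = extension S p
    periodic : Periodic g p
    periodic = extension-periodic S p
    agrees : ∀ t → t < n → at S t ≡ g t
    agrees = extension-agrees S p period-p
    prefix : ∀ a → a < k → ∀ b → b < p ∸ 2 → at S b ≡ g (a * p + b)
    prefix a _ b b< = trans (agrees b (in-prefix b<)) (sym (periodic-steps g p periodic a b))
    middle : ∀ t → t < n → at S t ≡ g (k * p + t)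
    middle t t< = trans (agrees t t<) (sym (periodic-steps g p periodic k t))
    position : ∀ a z → k * p + (n + (a * p + (2 + z))) ≡ suc (k + a) * p + (q + z)
    position a z = begin
      k * p + (n + (a * p + (2 + z)))  ≡⟨ regroup (k * p) (a * p) n z ⟩
      k * p + a * p + (n + 2) + z      ≡⟨ cong (λ m → k * p + a * p + m + z) n+2≡p+q ⟩
      k * p + a * p + (p + q) + z      ≡⟨ collect k a p q z ⟩
      suc (k + a) * p + (q + z)        ∎
      where
      regroup : ∀ x y m z → x + (m + (y + (2 + z))) ≡ x + y + (m + 2) + z
      regroup = solve-∀
      collect : ∀ k a p q z → k * p + a * p + (p + q) + z ≡ suc (k + a) * p + (q + z)
      collect = solve-∀
    suffix : ∀ a → a < k → ∀ z → z < p ∸ 2 → at S (q + z) ≡ g (k * p + (n + (a * p + (2 + z))))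
    suffix a _ z z< = begin
      at S (q + z)                         ≡⟨ agrees (q + z) (in-suffix z<) ⟩
      g (q + z)                            ≡⟨ periodic-steps g p periodic (suc (k + a)) (q + z) ⟨
      g (suc (k + a) * p + (q + z))        ≡⟨ cong g (position a z) ⟨
      g (k * p + (n + (a * p + (2 + z))))  ∎

  -- Period q: the q-periodic extension of S, shifted by E = q - kp so that it
  -- agrees with S on the middle copy of S.
  E : ℕ
  E = q ∸ k * p

  kp+E≡q : k * p + E ≡ q
  kp+E≡q = m+[n∸m]≡n kp≤q

  strongPeriod-q : StrongPeriod W q
  strongPeriod-q =
    matches⇒strongPeriod (some-letter S 0<n) W q h periodic (matches-W h prefix middle suffix)
    where
    open ≡-Reasoning
    g h : ℕ → Maybe A
    g = extension S q
    h x = g (x + E)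
    agrees : ∀ t → t < n → at S t ≡ g t
    agrees = extension-agrees S q period-q
    periodic : Periodic h q
    periodic x = trans (cong g (swap x q E)) (extension-periodic S q (x + E))
      where
      swap : ∀ x y z → x + y + z ≡ x + z + y
      swap = solve-∀
    middle : ∀ t → t < n → at S t ≡ h (k * p + t)
    middle t t< = begin
      at S t              ≡⟨ agrees t t< ⟩
      g t                 ≡⟨ extension-periodic S q t ⟨
      g (t + q)           ≡⟨ cong (λ m → g (t + m)) kp+E≡q ⟨
      g (t + (k * p + E)) ≡⟨ cong g (regroup (k * p) t E) ⟩
      h (k * p + t)       ∎
      where
      regroup : ∀ x t e → t + (x + e) ≡ x + t + e
      regroup = solve-∀
    -- S[b] = S[b + q], and b + q lies (k - a)p steps after the position a p + b + E.
    prefix : ∀ a → a < k → ∀ b → b < p ∸ 2 → at S b ≡ h (a * p + b)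
    prefix a a<k b b< = begin
      at S b               ≡⟨ proj₂ period-q b b+q<n ⟩
      at S (b + q)         ≡⟨ cong (at S) position ⟩
      at S (x + m * p)     ≡⟨ period-steps S p period-p m x (subst (_< n) position b+q<n) ⟨
      at S x               ≡⟨ agrees x (≤-<-trans (m≤m+n x (m * p)) (subst (_< n) position b+q<n)) ⟩
      h (a * p + b)        ∎
      where
      m x : ℕ
      m = k ∸ a
      x = a * p + b + E
      b+q<n : b + q < n
      b+q<n = subst (_< n) (+-comm q b) (in-suffix b<)
      position : b + q ≡ x + m * p
      position = begin
        b + q                  ≡⟨ cong (b +_) kp+E≡q ⟨
        b + (k * p + E)        ≡⟨ cong (λ c → b + (c * p + E)) (m+[n∸m]≡n (<⇒≤ a<k)) ⟨
        b + ((a + m) * p + E)  ≡⟨ regroup a m p b E ⟩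
        x + m * p              ∎
        where
        regroup : ∀ a m p b e → b + ((a + m) * p + e) ≡ a * p + b + e + m * p
        regroup = solve-∀
    -- S[q + z] = S[z] = S[z + (a+1)p], and the suffix position is z + (a+1)p plus 2q.
    suffix : ∀ a → a < k → ∀ z → z < p ∸ 2 → at S (q + z) ≡ h (k * p + (n + (a * p + (2 + z))))
    suffix a a<k z z< = begin
      at S (q + z)        ≡⟨ cong (at S) (+-comm q z) ⟩
      at S (z + q)        ≡⟨ proj₂ period-q z z+q<n ⟨
      at S z              ≡⟨ period-steps S p period-p (suc a) z y<n ⟩
      at S y              ≡⟨ agrees y y<n ⟩
      g y                 ≡⟨ periodic-steps g q (extension-periodic S q) 2 y ⟨
      g (2 * q + y)       ≡⟨ cong g position ⟨
      h (k * p + (n + (a * p + (2 + z))))  ∎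
      where
      y : ℕ
      y = z + suc a * p
      z+q<n : z + q < n
      z+q<n = subst (_< n) (+-comm q z) (in-suffix z<)
      y<n : y < n
      y<n = ≤-<-trans (+-monoʳ-≤ z (≤-trans (*-monoˡ-≤ p a<k) kp≤q)) z+q<n
      position : k * p + (n + (a * p + (2 + z))) + E ≡ 2 * q + y
      position = begin
        k * p + (n + (a * p + (2 + z))) + E  ≡⟨ regroup (k * p) (a * p) n z E ⟩
        (k * p + E) + (n + 2) + (a * p + z)  ≡⟨ cong₂ (λ c d → c + d + (a * p + z)) kp+E≡q n+2≡p+q ⟩
        q + (p + q) + (a * p + z)            ≡⟨ collect a p q z ⟩
        2 * q + y                            ∎
        where
        regroup : ∀ x y m z e → x + (m + (y + (2 + z))) + e ≡ (x + e) + (m + 2) + (y + z)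
        regroup = solve-∀
        collect : ∀ a p q z → q + (p + q) + (a * p + z) ≡ 2 * q + (z + suc a * p)
        collect = solve-∀

lemma6 : {A : Set} (p q : ℕ) .{{_ : NonZero p}} → 1 < p → p < q → Coprime p q →
    (S : List A) → length S ≡ p + q ∸ 2 →
    Period S p → Period S q → ¬ Period S 1 →
    let k = q / p
        W = ((solid (factor S 0 (p ∸ 2)) ++ ♢ ∷ ♢ ∷ []) ^^ k)
            ++ solid S
            ++ ((♢ ∷ ♢ ∷ solid (factor S q (p ∸ 2))) ^^ k)
    in StrongPeriod W p × StrongPeriod W q
lemma6 p q 1<p p<q _ S length≡ period-p period-q _ = strongPeriod-p , strongPeriod-q
  where open Construction p q 1<p p<q S length≡ period-p period-q
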